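{- Let $n \geq 4$ be a natural number and let $(a_1,a_2,a_3), (b_1,b_2,b_3)$ be arbitrary vertices of the cubical staircase graph $CS_n$. Then $$d_{CS_n}\big((a_1,a_2,a_3),(b_1,b_2,b_3)\big) = |a_1-b_1| + |a_2-b_2| + |a_3-b_3|.$$
   Context: For a natural number $n \geq 3$, the cubical staircase graph $CS_n$ is the graph with vertex set $\{(i,j,k) : 1 \leq i \leq n-2,\ 1 \leq j \leq i,\ 1 \leq k \leq n-1-i\}$ and edge set consisting of the pairs $(i,j,k)(i,j,k+1)$ for $1\le i\le n-2$, $1\le j\le i$, $1\le k\le n-2-i$; the pairs $(i,j,k)(i+1,j,k)$ for $1\le i\le n-3$, $1\le j\le i$, $1\le k\le n-1-i$; and the pairs $(i,j,k)(i,j+1,k)$ for $1\le i\le n-2$, $1\le j\le i-1$, $1\le k\le n-1-i$ (only pairs of vertices of $CS_n$ are included). $d_G(u,v)$ denotes the length of a shortest path between $u$ and $v$ in $G$. -}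

module Defs where

open import Data.Nat using (ℕ; suc; _+_; _∸_; _≤_)
open import Data.Product using (_×_; _,_; ∃-syntax)
open import Data.Sum using (_⊎_)

Triple : Set
Triple = ℕ × ℕ × ℕ

IsVertex : ℕ → Triple → Set
IsVertex n (i , j , k) =
  (1 ≤ i × i ≤ n ∸ 2) × (1 ≤ j × j ≤ i) × (1 ≤ k × k ≤ n ∸ 1 ∸ i)

data Edge (n : ℕ) : Triple → Triple → Set where
  edge-k : ∀ {i j k} → 1 ≤ i → i ≤ n ∸ 2 → 1 ≤ j → j ≤ i → 1 ≤ k → k ≤ n ∸ 2 ∸ i →
           IsVertex n (i , j , k) → IsVertex n (i , j , suc k) →
           Edge n (i , j , k) (i , j , suc k)
  edge-i : ∀ {i j k} → 1 ≤ i → i ≤ n ∸ 3 → 1 ≤ j → j ≤ i → 1 ≤ k → k ≤ n ∸ 1 ∸ i →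
           IsVertex n (i , j , k) → IsVertex n (suc i , j , k) →
           Edge n (i , j , k) (suc i , j , k)
  edge-j : ∀ {i j k} → 1 ≤ i → i ≤ n ∸ 2 → 1 ≤ j → j ≤ i ∸ 1 → 1 ≤ k → k ≤ n ∸ 1 ∸ i →
           IsVertex n (i , j , k) → IsVertex n (i , suc j , k) →
           Edge n (i , j , k) (i , suc j , k)

Adj : ℕ → Triple → Triple → Set
Adj n u v = Edge n u v ⊎ Edge n v u

data Walk (n : ℕ) : Triple → Triple → ℕ → Set where
  [] : ∀ {u} → Walk n u u 0
  _∷_ : ∀ {u v w ℓ} → Adj n u v → Walk n v w ℓ → Walk n u w (suc ℓ)

-- d_{CS_n}(u,v) = d : there is a walk of length d from u to v and
-- every walk from u to v has length at least d (shortest walk length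
-- equals shortest path length).
Dist : ℕ → Triple → Triple → ℕ → Set
Dist n u v d = Walk n u v d × (∀ ℓ → Walk n u v ℓ → d ≤ ℓ)

-- Going from a to b needs at least ∣a₁-b₁∣ + ∣a₂-b₂∣ + ∣a₃-b₃∣ steps, because adjacent
-- vertices are at ℓ₁-distance 1. This many steps suffice: the vertex set is closed
-- under decreasing j and k (down to 1) and convex along each coordinate line, so one
-- can lower k to min(a₃,b₃) and j to min(a₂,b₂), move i from a₁ to b₁ (legal since
-- j ≤ min(a₁,b₁) and k is minimal), and then raise j to b₂ and k to b₃.
module Submission where

open import Defs
open import Data.Nat using (ℕ; zero; suc; _+_; _∸_; _≤_; _<_; ∣_-_∣; _⊓_; s≤s)
open import Data.Nat.Properties
open import Data.Product using (_,_)
open import Data.Sum using (inj₁; inj₂; swap)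
open import Relation.Binary.PropositionalEquality
open import Algebra.Properties.CommutativeSemigroup +-commutativeSemigroup using (interchange)
open import Data.Nat.Tactic.RingSolver using (solve-∀)

+≤⇒≤∸ : ∀ a {m o} → a + m ≤ o → m ≤ o ∸ a
+≤⇒≤∸ a {m} {o} a+m≤o = m+n≤o⇒m≤o∸n m (subst (_≤ o) (+-comm a m) a+m≤o)

+≤⇒≤∸∸ : ∀ a b {m o} → a + b + m ≤ o → m ≤ o ∸ a ∸ b
+≤⇒≤∸∸ a b {m} {o} h = subst (m ≤_) (sym (∸-+-assoc o a b)) (+≤⇒≤∸ (a + b) h)

≤∸⇒+≤ : ∀ {a m o} → 1 ≤ m → m ≤ o ∸ a → a + m ≤ o
≤∸⇒+≤ {zero}              _       m≤o   = m≤o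
≤∸⇒+≤ {suc a} {o = zero}  (s≤s _) ()
≤∸⇒+≤ {suc a} {o = suc o} 1≤m     m≤o∸a = s≤s (≤∸⇒+≤ 1≤m m≤o∸a)

∣n-1+n∣≡1 : ∀ n → ∣ n - suc n ∣ ≡ 1
∣n-1+n∣≡1 zero    = refl
∣n-1+n∣≡1 (suc n) = ∣n-1+n∣≡1 n

∣m-m⊓n∣+∣m⊓n-n∣≡∣m-n∣ : ∀ m n → ∣ m - m ⊓ n ∣ + ∣ m ⊓ n - n ∣ ≡ ∣ m - n ∣
∣m-m⊓n∣+∣m⊓n-n∣≡∣m-n∣ m n with ≤-total m n
... | inj₁ m≤n rewrite m≤n⇒m⊓n≡m m≤n | ∣n-n∣≡0 m = refl
... | inj₂ n≤m rewrite m≥n⇒m⊓n≡n n≤m | ∣n-n∣≡0 n = +-identityʳ _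

-- IsVertex with its truncated subtractions cleared.
record Staircase (n i j k : ℕ) : Set where
  field
    1≤j   : 1 ≤ j
    j≤i   : j ≤ i
    1≤k   : 1 ≤ k
    i+k<n : i + k < n

open Staircase

isVertex⇒staircase : ∀ {n i j k} → IsVertex n (i , j , k) → Staircase n i j k
isVertex⇒staircase {n} {i} {k = k} (_ , (1≤j , j≤i) , (1≤k , k≤n∸1∸i)) = record
  { 1≤j = 1≤j ; j≤i = j≤i ; 1≤k = 1≤k
  ; i+k<n = ≤∸⇒+≤ 1≤k (subst (k ≤_) (∸-+-assoc n 1 i) k≤n∸1∸i)
  }

staircase⇒isVertex : ∀ {n i j k} → Staircase n i j k → IsVertex n (i , j , k)
staircase⇒isVertex {i = i} s =
  (≤-trans (1≤j s) (j≤i s) , +≤⇒≤∸ 2 (≤-trans (s≤s (m<m+n i (1≤k s))) (i+k<n s)))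
  , (1≤j s , j≤i s) , (1≤k s , +≤⇒≤∸∸ 1 i (i+k<n s))

staircase-lower : ∀ {n i j k j′ k′} → Staircase n i j k →
                  1 ≤ j′ → j′ ≤ j → 1 ≤ k′ → k′ ≤ k → Staircase n i j′ k′
staircase-lower {i = i} s 1≤j′ j′≤j 1≤k′ k′≤k = record
  { 1≤j = 1≤j′ ; j≤i = ≤-trans j′≤j (j≤i s) ; 1≤k = 1≤k′
  ; i+k<n = ≤-trans (s≤s (+-monoʳ-≤ i k′≤k)) (i+k<n s)
  }

adj-k : ∀ {n i j k} → Staircase n i j k → Staircase n i j (suc k) →
        Adj n (i , j , k) (i , j , suc k)
adj-k {n} {i} {k = k} s s′
  with staircase⇒isVertex s
... | u@((1≤i , i≤n∸2) , (1≤j , j≤i) , (1≤k , _)) =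
  inj₁ (edge-k 1≤i i≤n∸2 1≤j j≤i 1≤k
    (+≤⇒≤∸∸ 2 i (subst (_≤ n) (cong suc (+-suc i k)) (i+k<n s′)))
    u (staircase⇒isVertex s′))

adj-j : ∀ {n i j k} → Staircase n i j k → Staircase n i (suc j) k →
        Adj n (i , j , k) (i , suc j , k)
adj-j s s′
  with staircase⇒isVertex s
... | u@((1≤i , i≤n∸2) , (1≤j , _) , (1≤k , k≤n∸1∸i)) =
  inj₁ (edge-j 1≤i i≤n∸2 1≤j (+≤⇒≤∸ 1 (j≤i s′)) 1≤k k≤n∸1∸i u (staircase⇒isVertex s′))

adj-i : ∀ {n i j k} → Staircase n i j k → Staircase n (suc i) j k →
        Adj n (i , j , k) (suc i , j , k)
adj-i {i = i} s s′
  with staircase⇒isVertex s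
... | u@((1≤i , _) , (1≤j , j≤i) , (1≤k , k≤n∸1∸i)) =
  inj₁ (edge-i 1≤i (+≤⇒≤∸ 3 (≤-trans (s≤s (m<m+n (suc i) 1≤k)) (i+k<n s′)))
    1≤j j≤i 1≤k k≤n∸1∸i u (staircase⇒isVertex s′))

module _ {n : ℕ} where

  _++_ : ∀ {u v w a b} → Walk n u v a → Walk n v w b → Walk n u w (a + b)
  []      ++ q = q
  (e ∷ p) ++ q = e ∷ (p ++ q)

  snoc : ∀ {u v w ℓ} → Walk n u v ℓ → Adj n v w → Walk n u w (suc ℓ)
  snoc []      e = e ∷ []
  snoc (a ∷ p) e = a ∷ snoc p e

  reverse : ∀ {u v ℓ} → Walk n u v ℓ → Walk n v u ℓ
  reverse []      = []
  reverse (e ∷ p) = snoc (reverse p) (swap e)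

module Segment {n : ℕ} (P : ℕ → Set) (f : ℕ → Triple)
  (convex : ∀ {x y z} → P x → P z → x ≤ y → y ≤ z → P y)
  (adj : ∀ {x} → P x → P (suc x) → Adj n (f x) (f (suc x))) where

  ascend-by : ∀ d x → P x → P (d + x) → Walk n (f x) (f (d + x)) d
  ascend-by zero    x px _      = []
  ascend-by (suc d) x px p1+d+x = snoc (ascend-by d x px pd+x) (adj pd+x p1+d+x)
    where
    pd+x : P (d + x)
    pd+x = convex px p1+d+x (m≤n+m x d) (n≤1+n (d + x))

  ascend-≤ : ∀ {x y} → x ≤ y → P x → P y → Walk n (f x) (f y) (y ∸ x)
  ascend-≤ {x} {y} x≤y px py =
    subst (λ z → Walk n (f x) (f z) (y ∸ x)) (m∸n+n≡m x≤y)
      (ascend-by (y ∸ x) x px (subst P (sym (m∸n+n≡m x≤y)) py))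

  segment : ∀ {x y} → P x → P y → Walk n (f x) (f y) ∣ x - y ∣
  segment {x} {y} px py with ≤-total x y
  ... | inj₁ x≤y = subst (Walk n (f x) (f y)) (sym (m≤n⇒∣m-n∣≡n∸m x≤y)) (ascend-≤ x≤y px py)
  ... | inj₂ y≤x = subst (Walk n (f x) (f y)) (trans (sym (m≤n⇒∣m-n∣≡n∸m y≤x)) (∣-∣-comm y x))
                     (reverse (ascend-≤ y≤x py px))

segment-k : ∀ {n i j k k′} → Staircase n i j k → Staircase n i j k′ →
            Walk n (i , j , k) (i , j , k′) ∣ k - k′ ∣
segment-k {n} {i} {j} = Segment.segment (Staircase n i j) (λ k → i , j , k) convex adj-k
  where
  convex : ∀ {x y z} → Staircase n i j x → Staircase n i j z → x ≤ y → y ≤ z → Staircase n i j y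
  convex sx sz x≤y y≤z = record
    { 1≤j = 1≤j sx ; j≤i = j≤i sx ; 1≤k = ≤-trans (1≤k sx) x≤y
    ; i+k<n = ≤-trans (s≤s (+-monoʳ-≤ i y≤z)) (i+k<n sz)
    }

segment-j : ∀ {n i j j′ k} → Staircase n i j k → Staircase n i j′ k →
            Walk n (i , j , k) (i , j′ , k) ∣ j - j′ ∣
segment-j {n} {i} {k = k} = Segment.segment (λ j → Staircase n i j k) (λ j → i , j , k) convex adj-j
  where
  convex : ∀ {x y z} → Staircase n i x k → Staircase n i z k → x ≤ y → y ≤ z → Staircase n i y k
  convex sx sz x≤y y≤z = record
    { 1≤j = ≤-trans (1≤j sx) x≤y ; j≤i = ≤-trans y≤z (j≤i sz) ; 1≤k = 1≤k sx ; i+k<n = i+k<n sx }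

segment-i : ∀ {n i i′ j k} → Staircase n i j k → Staircase n i′ j k →
            Walk n (i , j , k) (i′ , j , k) ∣ i - i′ ∣
segment-i {n} {j = j} {k} = Segment.segment (λ i → Staircase n i j k) (λ i → i , j , k) convex adj-i
  where
  convex : ∀ {x y z} → Staircase n x j k → Staircase n z j k → x ≤ y → y ≤ z → Staircase n y j k
  convex sx sz x≤y y≤z = record
    { 1≤j = 1≤j sx ; j≤i = ≤-trans (j≤i sx) x≤y ; 1≤k = 1≤k sx
    ; i+k<n = ≤-trans (s≤s (+-monoˡ-≤ k y≤z)) (i+k<n sz)
    }

ℓ₁ : Triple → Triple → ℕ
ℓ₁ (a₁ , a₂ , a₃) (b₁ , b₂ , b₃) = ∣ a₁ - b₁ ∣ + ∣ a₂ - b₂ ∣ + ∣ a₃ - b₃ ∣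

ℓ₁-walk : ∀ {n a₁ a₂ a₃ b₁ b₂ b₃} → Staircase n a₁ a₂ a₃ → Staircase n b₁ b₂ b₃ →
          Walk n (a₁ , a₂ , a₃) (b₁ , b₂ , b₃) (ℓ₁ (a₁ , a₂ , a₃) (b₁ , b₂ , b₃))
ℓ₁-walk {n} {a₁} {a₂} {a₃} {b₁} {b₂} {b₃} sa sb =
  subst (Walk n _ _) length-eq
    (segment-k sa a↓k ++ (segment-j a↓k a↓jk ++ (segment-i a↓jk b↓jk ++
      (segment-j b↓jk b↓k ++ segment-k b↓k sb))))
  where
  j₀ k₀ : ℕ
  j₀ = a₂ ⊓ b₂
  k₀ = a₃ ⊓ b₃
  1≤j₀ : 1 ≤ j₀
  1≤j₀ = ⊓-glb (1≤j sa) (1≤j sb)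
  1≤k₀ : 1 ≤ k₀
  1≤k₀ = ⊓-glb (1≤k sa) (1≤k sb)
  a↓k : Staircase n a₁ a₂ k₀
  a↓k = staircase-lower sa (1≤j sa) ≤-refl 1≤k₀ (m⊓n≤m a₃ b₃)
  a↓jk : Staircase n a₁ j₀ k₀
  a↓jk = staircase-lower sa 1≤j₀ (m⊓n≤m a₂ b₂) 1≤k₀ (m⊓n≤m a₃ b₃)
  b↓jk : Staircase n b₁ j₀ k₀
  b↓jk = staircase-lower sb 1≤j₀ (m⊓n≤n a₂ b₂) 1≤k₀ (m⊓n≤n a₃ b₃)
  b↓k : Staircase n b₁ b₂ k₀
  b↓k = staircase-lower sb (1≤j sb) ≤-refl 1≤k₀ (m⊓n≤n a₃ b₃)
  rearrange : ∀ r q p q′ r′ → r + (q + (p + (q′ + r′))) ≡ p + (q + q′) + (r + r′)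
  rearrange = solve-∀
  length-eq : ∣ a₃ - k₀ ∣ + (∣ a₂ - j₀ ∣ + (∣ a₁ - b₁ ∣ + (∣ j₀ - b₂ ∣ + ∣ k₀ - b₃ ∣)))
            ≡ ℓ₁ (a₁ , a₂ , a₃) (b₁ , b₂ , b₃)
  length-eq = trans (rearrange ∣ a₃ - k₀ ∣ ∣ a₂ - j₀ ∣ ∣ a₁ - b₁ ∣ ∣ j₀ - b₂ ∣ ∣ k₀ - b₃ ∣)
    (cong₂ (λ s t → ∣ a₁ - b₁ ∣ + s + t) (∣m-m⊓n∣+∣m⊓n-n∣≡∣m-n∣ a₂ b₂) (∣m-m⊓n∣+∣m⊓n-n∣≡∣m-n∣ a₃ b₃))

ℓ₁-self : ∀ u → ℓ₁ u u ≡ 0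
ℓ₁-self (a₁ , a₂ , a₃) rewrite ∣n-n∣≡0 a₁ | ∣n-n∣≡0 a₂ | ∣n-n∣≡0 a₃ = refl

ℓ₁-comm : ∀ u v → ℓ₁ u v ≡ ℓ₁ v u
ℓ₁-comm (a₁ , a₂ , a₃) (b₁ , b₂ , b₃)
  rewrite ∣-∣-comm a₁ b₁ | ∣-∣-comm a₂ b₂ | ∣-∣-comm a₃ b₃ = refl

ℓ₁-triangle : ∀ u v w → ℓ₁ u w ≤ ℓ₁ u v + ℓ₁ v w
ℓ₁-triangle (a₁ , a₂ , a₃) (b₁ , b₂ , b₃) (c₁ , c₂ , c₃) = begin
  ∣ a₁ - c₁ ∣ + ∣ a₂ - c₂ ∣ + ∣ a₃ - c₃ ∣
    ≤⟨ +-mono-≤ (+-mono-≤ (∣-∣-triangle a₁ b₁ c₁) (∣-∣-triangle a₂ b₂ c₂)) (∣-∣-triangle a₃ b₃ c₃) ⟩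
  (x₁ + y₁) + (x₂ + y₂) + (x₃ + y₃)
    ≡⟨ cong (_+ (x₃ + y₃)) (interchange x₁ y₁ x₂ y₂) ⟩
  (x₁ + x₂) + (y₁ + y₂) + (x₃ + y₃)
    ≡⟨ interchange (x₁ + x₂) (y₁ + y₂) x₃ y₃ ⟩
  (x₁ + x₂ + x₃) + (y₁ + y₂ + y₃) ∎
  where
  open ≤-Reasoning
  x₁ x₂ x₃ y₁ y₂ y₃ : ℕ
  x₁ = ∣ a₁ - b₁ ∣ ; x₂ = ∣ a₂ - b₂ ∣ ; x₃ = ∣ a₃ - b₃ ∣
  y₁ = ∣ b₁ - c₁ ∣ ; y₂ = ∣ b₂ - c₂ ∣ ; y₃ = ∣ b₃ - c₃ ∣

ℓ₁-edge : ∀ {n u v} → Edge n u v → ℓ₁ u v ≡ 1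
ℓ₁-edge (edge-k {i} {j} {k} _ _ _ _ _ _ _ _) rewrite ∣n-n∣≡0 i | ∣n-n∣≡0 j = ∣n-1+n∣≡1 k
ℓ₁-edge (edge-i {i} {j} {k} _ _ _ _ _ _ _ _)
  rewrite ∣n-1+n∣≡1 i | ∣n-n∣≡0 j | ∣n-n∣≡0 k = refl
ℓ₁-edge (edge-j {i} {j} {k} _ _ _ _ _ _ _ _)
  rewrite ∣n-n∣≡0 i | ∣n-1+n∣≡1 j | ∣n-n∣≡0 k = refl

ℓ₁-adj : ∀ {n u v} → Adj n u v → ℓ₁ u v ≡ 1
ℓ₁-adj         (inj₁ e) = ℓ₁-edge e
ℓ₁-adj {u = u} (inj₂ e) = trans (ℓ₁-comm u _) (ℓ₁-edge e)

ℓ₁≤length : ∀ {n u w ℓ} → Walk n u w ℓ → ℓ₁ u w ≤ ℓ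
ℓ₁≤length {u = u} []                             = ≤-reflexive (ℓ₁-self u)
ℓ₁≤length {u = u} {w} (_∷_ {v = v} {ℓ = ℓ} e p) = begin
  ℓ₁ u w           ≤⟨ ℓ₁-triangle u v w ⟩
  ℓ₁ u v + ℓ₁ v w  ≡⟨ cong (_+ ℓ₁ v w) (ℓ₁-adj e) ⟩
  suc (ℓ₁ v w)     ≤⟨ s≤s (ℓ₁≤length p) ⟩
  suc ℓ            ∎
  where open ≤-Reasoning

lemma2 : (n : ℕ) → 4 ≤ n → (a₁ a₂ a₃ b₁ b₂ b₃ : ℕ) →
    IsVertex n (a₁ , a₂ , a₃) → IsVertex n (b₁ , b₂ , b₃) →
    Dist n (a₁ , a₂ , a₃) (b₁ , b₂ , b₃) (∣ a₁ - b₁ ∣ + ∣ a₂ - b₂ ∣ + ∣ a₃ - b₃ ∣)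
lemma2 n _ a₁ a₂ a₃ b₁ b₂ b₃ a∈CSₙ b∈CSₙ =
  ℓ₁-walk (isVertex⇒staircase a∈CSₙ) (isVertex⇒staircase b∈CSₙ) , λ _ → ℓ₁≤length
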